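{- Let $d\ge 5$ be a prime and consider, in $\mathbb{F}_d^2$, the lines $L_a:\ ax-(a+1)y-p(a)=0$ for $a\in\mathbb{F}_d$, where $p$ is the polynomial defined below. Let $\iota,\kappa,\lambda$ be the linear maps of $\mathbb{F}_d^2$ given by $\iota(x,y)=(y,x)$, $\kappa(x,y)=(x-y,-y)$, $\lambda(x,y)=(-x,y-x)$. Then for every $\gamma\in\{\iota,\kappa,\lambda\}$ and every $a\in\mathbb{F}_d\setminus\{0,-1\}$, if $L_a$ and its image $\gamma(L_a)$ are two distinct lines, then every point of $L_a\cap\gamma(L_a)$ lies in the set of fixed points of $\gamma$ (which is a line of $\mathbb{F}_d^2$).
   Context: $p$ is the polynomial over $\mathbb{F}_d$ given by $p(x)=\frac{(x+1)^d-x^d-1}{d}=\sum_{k=1}^{d-1}\frac{1}{d}\binom{d}{k}x^k$, i.e. the integer-coefficient polynomial $((x+1)^d-x^d-1)/d$ reduced modulo $d$. For a map $\gamma\in GL_2(\mathbb{F}_d)$ and a line $L$, $\gamma(L)$ denotes the image line. One has $\kappa=\theta\circ\iota$ and $\lambda=\iota\circ\theta$ where $\theta(x,y)=(y-x,-x)$; $\iota,\kappa,\lambda$ are of order 2. -}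

module Defs where

open import Data.Nat using (ℕ; zero; suc; _+_; _*_; _∸_; _^_; NonZero)
open import Data.Nat.DivMod using (_mod_; _/_)
open import Data.Nat.Combinatorics using (_C_)
open import Data.Fin using (Fin; toℕ)
open import Data.List using (List; map; upTo)
open import Data.Nat.ListAction using (sum)
open import Data.Product using (_×_; _,_; ∃)
open import Relation.Binary.PropositionalEquality using (_≡_)
open import Relation.Nullary using (¬_)

module _ (d : ℕ) .{{_ : NonZero d}} where

  F : Set
  F = Fin d

  infixl 6 _⊕_ _⊖_
  infixl 7 _⊛_

  fromNat : ℕ → F
  fromNat n = n mod d

  _⊕_ : F → F → F
  x ⊕ y = (toℕ x + toℕ y) mod d

  _⊛_ : F → F → F
  x ⊛ y = (toℕ x * toℕ y) mod d

  ⊝_ : F → F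
  ⊝ x = (d ∸ toℕ x) mod d

  _⊖_ : F → F → F
  x ⊖ y = x ⊕ (⊝ y)

  p : F → F
  p a = sum (map (λ k → ((d C k) / d) * (toℕ a ^ k)) (map suc (upTo (d ∸ 1)))) mod d

  Point : Set
  Point = F × F

  _∈L_ : Point → F → Set
  (x , y) ∈L a = (a ⊛ x) ⊖ ((a ⊕ fromNat 1) ⊛ y) ⊖ p a ≡ fromNat 0

data Inv : Set where
  ι κ λ′ : Inv

module _ (d : ℕ) .{{_ : NonZero d}} where

  apply : Inv → Point d → Point d
  apply ι  (x , y) = (y , x)
  apply κ  (x , y) = (_⊖_ d x y , ⊝_ d y)
  apply λ′ (x , y) = (⊝_ d x , _⊖_ d y x)

  _∈γL_[_] : Point d → Inv → F d → Set
  P ∈γL γ [ a ] = ∃ λ q → _∈L_ d q a × apply γ q ≡ P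

  Distinct : Inv → F d → Set
  Distinct γ a = ¬ (∀ P → (_∈L_ d P a → P ∈γL γ [ a ]) × (P ∈γL γ [ a ] → _∈L_ d P a))

  Fixed : Inv → Point d → Set
  Fixed γ P = apply γ P ≡ P

module Submission where

-- Lift everything to ℤ and work modulo d.  Write
--   A(x , y) = a x - (a + 1) y - p(a)
-- for the affine form cutting out L_a.  For each involution γ there are an
-- integer "shift" c_γ(a) and a linear "axis form" w_γ, vanishing exactly on
-- the fixed line of γ, such that identically
--   A(γ z) = A(z) + c_γ(a) · w_γ(z)
-- (c_ι = 2a + 1, w_ι = y - x;  c_κ = a + 2, w_κ = y;  c_λ = 1 - a, w_λ = x).
-- Let P ∈ L_a ∩ γ(L_a), say P = γ q with q ∈ L_a.  Then A(q) ≡ A(γ q) ≡ 0,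
-- hence c_γ(a) · w_γ(q) ≡ 0 (mod d), and since d is prime one factor vanishes.
-- If c_γ(a) ≡ 0 then A(γ z) ≡ A(z) for all z, so L_a = γ(L_a), contradicting
-- distinctness.  Otherwise w_γ(q) ≡ 0, so q is fixed by γ and so is P = γ q.
-- The argument uses only that d is prime.

open import Defs
open import Data.Nat using (ℕ; NonZero; _≤_)
open import Data.Nat.Primality using (Prime)
open import Relation.Binary.PropositionalEquality using (_≢_)

import Data.Nat as ℕ
import Data.Nat.Properties as ℕ
open import Data.Nat.DivMod using (DivMod; _divMod_; _%_; [m+kn]%n≡m%n; m<n⇒m%n≡m)
open import Data.Nat.Divisibility using (_∣_; divides)
open import Data.Nat.Primality using (euclidsLemma)
open import Data.Integer using (ℤ; +_; -[1+_]; _+_; _*_; -_; _-_; ∣_∣)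
  renaming (_⊖_ to _⊖ℕ_)
import Data.Integer.Properties as ℤ
open import Data.Integer.Tactic.RingSolver using (solve-∀)
open import Data.Fin using (toℕ)
open import Data.Fin.Properties using (toℕ-injective; toℕ<n)
open import Data.Product using (_×_; _,_)
open import Data.Sum using (_⊎_; inj₁; inj₂)
open import Relation.Nullary using (¬_; contradiction)
open import Relation.Binary.PropositionalEquality
  using (_≡_; refl; sym; trans; cong; cong₂; subst; module ≡-Reasoning)

module Congruence (m : ℤ) where

  infix 4 _≈_
  infix 2 _,ₘ_

  record _≈_ (X Y : ℤ) : Set where
    constructor _,ₘ_
    field
      quotient : ℤ
      equation : X ≡ Y + quotient * m

  ≈-refl : ∀ {X} → X ≈ X
  ≈-refl {X} = + 0 ,ₘ plus-zero X m
    where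
    plus-zero : ∀ X m → X ≡ X + + 0 * m
    plus-zero = solve-∀

  ≡⇒≈ : ∀ {X Y} → X ≡ Y → X ≈ Y
  ≡⇒≈ refl = ≈-refl

  ≈-sym : ∀ {X Y} → X ≈ Y → Y ≈ X
  ≈-sym {Y = Y} (k ,ₘ refl) = - k ,ₘ cancel Y k m
    where
    cancel : ∀ Y k m → Y ≡ (Y + k * m) + (- k) * m
    cancel = solve-∀

  ≈-trans : ∀ {X Y Z} → X ≈ Y → Y ≈ Z → X ≈ Z
  ≈-trans {Z = Z} (k ,ₘ refl) (j ,ₘ refl) = j + k ,ₘ collect Z j k m
    where
    collect : ∀ Z j k m → (Z + j * m) + k * m ≡ Z + (j + k) * m
    collect = solve-∀

  +-cong : ∀ {X X′ Y Y′} → X ≈ X′ → Y ≈ Y′ → X + Y ≈ X′ + Y′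
  +-cong {X′ = X} {Y′ = Y} (k ,ₘ refl) (j ,ₘ refl) = k + j ,ₘ expand X Y k j m
    where
    expand : ∀ X Y k j m → (X + k * m) + (Y + j * m) ≡ (X + Y) + (k + j) * m
    expand = solve-∀

  *-cong : ∀ {X X′ Y Y′} → X ≈ X′ → Y ≈ Y′ → X * Y ≈ X′ * Y′
  *-cong {X′ = X} {Y′ = Y} (k ,ₘ refl) (j ,ₘ refl) =
    k * Y + j * X + k * j * m ,ₘ expand X Y k j m
    where
    expand : ∀ X Y k j m →
      (X + k * m) * (Y + j * m) ≡ X * Y + (k * Y + j * X + k * j * m) * m
    expand = solve-∀

  neg-cong : ∀ {X X′} → X ≈ X′ → - X ≈ - X′
  neg-cong {X′ = X} (k ,ₘ refl) = - k ,ₘ expand X k m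
    where
    expand : ∀ X k m → - (X + k * m) ≡ - X + (- k) * m
    expand = solve-∀

  −-cong : ∀ {X X′ Y Y′} → X ≈ X′ → Y ≈ Y′ → X - Y ≈ X′ - Y′
  −-cong X≈ Y≈ = +-cong X≈ (neg-cong Y≈)

  +-zeroʳ : ∀ X {W} → W ≈ + 0 → X + W ≈ X
  +-zeroʳ X W≈0 = ≈-trans (+-cong (≈-refl {X}) W≈0) (≡⇒≈ (ℤ.+-identityʳ X))

  zero-*ʳ : ∀ {C} W → C ≈ + 0 → C * W ≈ + 0
  zero-*ʳ W c = ≈-trans (*-cong c (≈-refl {W})) (≡⇒≈ (ℤ.*-zeroˡ W))

  infix 4 _≈ₚ_

  _≈ₚ_ : ℤ × ℤ → ℤ × ℤ → Set
  (x , y) ≈ₚ (x′ , y′) = x ≈ x′ × y ≈ y′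

  ≈ₚ-sym : ∀ {z z′} → z ≈ₚ z′ → z′ ≈ₚ z
  ≈ₚ-sym {_ , _} {_ , _} (x≈ , y≈) = ≈-sym x≈ , ≈-sym y≈

  ≈ₚ-trans : ∀ {z z′ z″} → z ≈ₚ z′ → z′ ≈ₚ z″ → z ≈ₚ z″
  ≈ₚ-trans {_ , _} {_ , _} {_ , _} (x≈ , y≈) (x≈′ , y≈′) = ≈-trans x≈ x≈′ , ≈-trans y≈ y≈′

  ≡⇒≈ₚ : ∀ {z z′} → z ≡ z′ → z ≈ₚ z′
  ≡⇒≈ₚ {_ , _} refl = ≈-refl , ≈-refl

module Residues (d : ℕ) .{{_ : NonZero d}} where

  open Congruence (+ d) public

  ⟦_⟧ : F d → ℤ
  ⟦ x ⟧ = + toℕ x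

  fromNat-≈ : ∀ n → ⟦ fromNat d n ⟧ ≈ + n
  fromNat-≈ n = - + q ,ₘ (begin
    ⟦ fromNat d n ⟧                      ≡⟨ cancel ⟦ fromNat d n ⟧ (+ q) (+ d) ⟩
    (⟦ fromNat d n ⟧ + + q * + d) + (- + q) * + d
      ≡⟨ cong (λ t → t + (- + q) * + d) (sym lifted) ⟩
    + n + (- + q) * + d                   ∎)
    where
    open ≡-Reasoning
    open DivMod (n divMod d) using () renaming (quotient to q; property to division)
    cancel : ∀ R q m → R ≡ (R + q * m) + (- q) * m
    cancel = solve-∀
    lifted : + n ≡ ⟦ fromNat d n ⟧ + + q * + d
    lifted = begin
      + n                                ≡⟨ cong +_ division ⟩
      + (toℕ (fromNat d n) ℕ.+ q ℕ.* d)  ≡⟨ ℤ.pos-+ (toℕ (fromNat d n)) (q ℕ.* d) ⟩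
      ⟦ fromNat d n ⟧ + + (q ℕ.* d)      ≡⟨ cong (λ t → ⟦ fromNat d n ⟧ + t) (ℤ.pos-* q d) ⟩
      ⟦ fromNat d n ⟧ + + q * + d        ∎

  ⊕-≈ : ∀ x y → ⟦ _⊕_ d x y ⟧ ≈ ⟦ x ⟧ + ⟦ y ⟧
  ⊕-≈ x y = ≈-trans (fromNat-≈ (toℕ x ℕ.+ toℕ y)) (≡⇒≈ (ℤ.pos-+ (toℕ x) (toℕ y)))

  ⊛-≈ : ∀ x y → ⟦ _⊛_ d x y ⟧ ≈ ⟦ x ⟧ * ⟦ y ⟧
  ⊛-≈ x y = ≈-trans (fromNat-≈ (toℕ x ℕ.* toℕ y)) (≡⇒≈ (ℤ.pos-* (toℕ x) (toℕ y)))

  ⊝-≈ : ∀ x → ⟦ ⊝_ d x ⟧ ≈ - ⟦ x ⟧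
  ⊝-≈ x = ≈-trans (fromNat-≈ (d ℕ.∸ toℕ x)) (+ 1 ,ₘ (begin
    + (d ℕ.∸ toℕ x)         ≡⟨ ℤ.⊖-≥ (ℕ.<⇒≤ (toℕ<n x)) ⟨
    d ⊖ℕ toℕ x              ≡⟨ ℤ.m-n≡m⊖n d (toℕ x) ⟨
    + d - ⟦ x ⟧              ≡⟨ reorder ⟦ x ⟧ (+ d) ⟩
    - ⟦ x ⟧ + + 1 * + d      ∎))
    where
    open ≡-Reasoning
    reorder : ∀ X m → m - X ≡ - X + + 1 * m
    reorder = solve-∀

  ⊖-≈ : ∀ x y → ⟦ _⊖_ d x y ⟧ ≈ ⟦ x ⟧ - ⟦ y ⟧
  ⊖-≈ x y = ≈-trans (⊕-≈ x (⊝_ d y)) (+-cong (≈-refl {⟦ x ⟧}) (⊝-≈ y))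

  -- A residue exceeding another by a nonnegative multiple of d equals it,
  -- because representatives lie in [0, d).
  residue-aligned : ∀ x y k → ⟦ x ⟧ ≡ ⟦ y ⟧ + + k * + d → x ≡ y
  residue-aligned x y k e = toℕ-injective (begin
    toℕ x                     ≡⟨ m<n⇒m%n≡m (toℕ<n x) ⟨
    toℕ x % d                 ≡⟨ cong (_% d) in-ℕ ⟩
    (toℕ y ℕ.+ k ℕ.* d) % d   ≡⟨ [m+kn]%n≡m%n (toℕ y) k d ⟩
    toℕ y % d                 ≡⟨ m<n⇒m%n≡m (toℕ<n y) ⟩
    toℕ y                     ∎)
    where
    open ≡-Reasoning
    in-ℕ : toℕ x ≡ toℕ y ℕ.+ k ℕ.* d
    in-ℕ = ℤ.+-injective (trans e (trans (cong (λ t → ⟦ y ⟧ + t) (sym (ℤ.pos-* k d)))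
                                         (sym (ℤ.pos-+ (toℕ y) (k ℕ.* d)))))

  residue-injective : ∀ x y → ⟦ x ⟧ ≈ ⟦ y ⟧ → x ≡ y
  residue-injective x y (+ k ,ₘ e)      = residue-aligned x y k e
  residue-injective x y (-[1+ k ] ,ₘ e) =
    sym (residue-aligned y x (ℕ.suc k) (swap ⟦ x ⟧ ⟦ y ⟧ (+ ℕ.suc k) (+ d) e))
    where
    swap : ∀ X Y K m → X ≡ Y + (- K) * m → Y ≡ X + K * m
    swap .(Y + (- K) * m) Y K m refl = cancel Y K m
      where
      cancel : ∀ Y K m → Y ≡ (Y + (- K) * m) + K * m
      cancel = solve-∀

  ≈0⇒∣ : ∀ X → X ≈ + 0 → d ∣ ∣ X ∣
  ≈0⇒∣ X (k ,ₘ e) = divides ∣ k ∣ (trans (cong ∣_∣ (trans e (ℤ.+-identityˡ (k * + d))))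
                                          (ℤ.abs-* k (+ d)))

  ∣⇒≈0 : ∀ X → d ∣ ∣ X ∣ → X ≈ + 0
  ∣⇒≈0 (+ n)      (divides q e) = + q ,ₘ
    trans (cong +_ e) (trans (ℤ.pos-* q d) (sym (ℤ.+-identityˡ (+ q * + d))))
  ∣⇒≈0 -[1+ n ] (divides q e) = - + q ,ₘ
    trans (cong (λ t → - + t) e) (trans (cong -_ (ℤ.pos-* q d)) (negate (+ q) (+ d)))
    where
    negate : ∀ Q m → - (Q * m) ≡ + 0 + (- Q) * m
    negate = solve-∀

  zero-product : Prime d → ∀ X Y → X * Y ≈ + 0 → X ≈ + 0 ⊎ Y ≈ + 0
  zero-product d-prime X Y XY≈0
    with euclidsLemma ∣ X ∣ ∣ Y ∣ d-prime (subst (d ∣_) (ℤ.abs-* X Y) (≈0⇒∣ (X * Y) XY≈0))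
  ... | inj₁ d∣X = inj₁ (∣⇒≈0 X d∣X)
  ... | inj₂ d∣Y = inj₂ (∣⇒≈0 Y d∣Y)

  ⟦_⟧ₚ : Point d → ℤ × ℤ
  ⟦ x , y ⟧ₚ = ⟦ x ⟧ , ⟦ y ⟧

  point-injective : ∀ P Q → ⟦ P ⟧ₚ ≈ₚ ⟦ Q ⟧ₚ → P ≡ Q
  point-injective (x , y) (x′ , y′) (x≈ , y≈) =
    cong₂ _,_ (residue-injective x x′ x≈) (residue-injective y y′ y≈)

-- The integer affine form α x - (α + 1) y - π; with α, π the representatives
-- of a and p(a) its zero set modulo d is the line L_a.
lineForm : ℤ → ℤ → ℤ × ℤ → ℤ
lineForm α π (x , y) = α * x - (α + + 1) * y - π

act : Inv → ℤ × ℤ → ℤ × ℤ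
act ι  (x , y) = (y , x)
act κ  (x , y) = (x - y , - y)
act λ′ (x , y) = (- x , y - x)

-- The shift c_γ(α) by which γ moves the form, and the axis form w_γ whose
-- zero set is the fixed line of γ.
shift : Inv → ℤ → ℤ
shift ι  α = α + α + + 1
shift κ  α = α + + 2
shift λ′ α = + 1 - α

axis : Inv → ℤ × ℤ → ℤ
axis ι  (x , y) = y - x
axis κ  (x , y) = y
axis λ′ (x , y) = x

lineForm-act : ∀ γ α π z → lineForm α π (act γ z) ≡ lineForm α π z + shift γ α * axis γ z
lineForm-act ι  α π (x , y) = identity α π x y
  where
  identity : ∀ α π x y →
    α * y - (α + + 1) * x - π ≡ (α * x - (α + + 1) * y - π) + (α + α + + 1) * (y - x)
  identity = solve-∀
lineForm-act κ  α π (x , y) = identity α π x y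
  where
  identity : ∀ α π x y →
    α * (x - y) - (α + + 1) * (- y) - π ≡ (α * x - (α + + 1) * y - π) + (α + + 2) * y
  identity = solve-∀
lineForm-act λ′ α π (x , y) = identity α π x y
  where
  identity : ∀ α π x y →
    α * (- x) - (α + + 1) * (y - x) - π ≡ (α * x - (α + + 1) * y - π) + (+ 1 - α) * x
  identity = solve-∀

act-involutive : ∀ γ z → act γ (act γ z) ≡ z
act-involutive ι  (x , y) = refl
act-involutive κ  (x , y) = cong₂ _,_ (identity₁ x y) (identity₂ y)
  where
  identity₁ : ∀ x y → x - y - - y ≡ x
  identity₁ = solve-∀
  identity₂ : ∀ y → - - y ≡ y
  identity₂ = solve-∀
act-involutive λ′ (x , y) = cong₂ _,_ (identity₁ x) (identity₂ x y)
  where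
  identity₁ : ∀ x → - - x ≡ x
  identity₁ = solve-∀
  identity₂ : ∀ x y → y - x - - x ≡ y
  identity₂ = solve-∀

module _ (m : ℤ) where

  open Congruence m

  lineForm-cong : ∀ α π {z z′} → z ≈ₚ z′ → lineForm α π z ≈ lineForm α π z′
  lineForm-cong α π {_ , _} {_ , _} (x≈ , y≈) =
    −-cong (−-cong (*-cong (≈-refl {α}) x≈) (*-cong (≈-refl {α + + 1}) y≈)) (≈-refl {π})

  act-cong : ∀ γ {z z′} → z ≈ₚ z′ → act γ z ≈ₚ act γ z′
  act-cong ι  {_ , _} {_ , _} (x≈ , y≈) = y≈ , x≈
  act-cong κ  {_ , _} {_ , _} (x≈ , y≈) = −-cong x≈ y≈ , neg-cong y≈
  act-cong λ′ {_ , _} {_ , _} (x≈ , y≈) = neg-cong x≈ , −-cong y≈ x≈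

  axis-zero⇒fixed : ∀ γ z → axis γ z ≈ + 0 → act γ z ≈ₚ z
  axis-zero⇒fixed ι  (x , y) w≈0 = y≈x , ≈-sym y≈x
    where
    y≈x : y ≈ x
    y≈x = ≈-trans (≡⇒≈ (identity x y)) (+-zeroʳ x w≈0)
      where
      identity : ∀ x y → y ≡ x + (y - x)
      identity = solve-∀
  axis-zero⇒fixed κ  (x , y) w≈0 = +-zeroʳ x (neg-cong w≈0) , ≈-trans (neg-cong w≈0) (≈-sym w≈0)
  axis-zero⇒fixed λ′ (x , y) w≈0 = ≈-trans (neg-cong w≈0) (≈-sym w≈0) , +-zeroʳ y (neg-cong w≈0)

module Model (d : ℕ) .{{_ : NonZero d}} where

  open Residues d

  equation-≈ : ∀ a x y →
    ⟦ _⊖_ d (_⊖_ d (_⊛_ d a x) (_⊛_ d (_⊕_ d a (fromNat d 1)) y)) (p d a) ⟧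
      ≈ lineForm ⟦ a ⟧ ⟦ p d a ⟧ (⟦ x ⟧ , ⟦ y ⟧)
  equation-≈ a x y =
    ≈-trans (⊖-≈ (_⊖_ d ax a+1y) (p d a))
      (−-cong (≈-trans (⊖-≈ ax a+1y) (−-cong (⊛-≈ a x) a+1y-≈)) (≈-refl {⟦ p d a ⟧}))
    where
    a+1 ax a+1y : F d
    a+1 = _⊕_ d a (fromNat d 1)
    ax = _⊛_ d a x
    a+1y = _⊛_ d a+1 y
    a+1-≈ : ⟦ a+1 ⟧ ≈ ⟦ a ⟧ + + 1
    a+1-≈ = ≈-trans (⊕-≈ a (fromNat d 1)) (+-cong (≈-refl {⟦ a ⟧}) (fromNat-≈ 1))
    a+1y-≈ : ⟦ a+1y ⟧ ≈ (⟦ a ⟧ + + 1) * ⟦ y ⟧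
    a+1y-≈ = ≈-trans (⊛-≈ a+1 y) (*-cong a+1-≈ (≈-refl {⟦ y ⟧}))

  ∈L⇒≈0 : ∀ a P → _∈L_ d P a → lineForm ⟦ a ⟧ ⟦ p d a ⟧ ⟦ P ⟧ₚ ≈ + 0
  ∈L⇒≈0 a (x , y) P∈L =
    ≈-trans (≈-sym (equation-≈ a x y)) (≈-trans (≡⇒≈ (cong ⟦_⟧ P∈L)) (fromNat-≈ 0))

  ≈0⇒∈L : ∀ a P → lineForm ⟦ a ⟧ ⟦ p d a ⟧ ⟦ P ⟧ₚ ≈ + 0 → _∈L_ d P a
  ≈0⇒∈L a (x , y) A≈0 =
    residue-injective _ _ (≈-trans (equation-≈ a x y) (≈-trans A≈0 (≈-sym (fromNat-≈ 0))))

  apply-≈ : ∀ γ q → ⟦ apply d γ q ⟧ₚ ≈ₚ act γ ⟦ q ⟧ₚ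
  apply-≈ ι  (x , y) = ≈-refl , ≈-refl
  apply-≈ κ  (x , y) = ⊖-≈ x y , ⊝-≈ y
  apply-≈ λ′ (x , y) = ⊝-≈ x , ⊖-≈ y x

  apply-involutive : ∀ γ q → apply d γ (apply d γ q) ≡ q
  apply-involutive γ q = point-injective _ _
    (≈ₚ-trans (apply-≈ γ (apply d γ q))
    (≈ₚ-trans (act-cong (+ d) γ (apply-≈ γ q)) (≡⇒≈ₚ (act-involutive γ ⟦ q ⟧ₚ))))

  module _ (γ : Inv) (a : F d) where

    private
      α π : ℤ
      α = ⟦ a ⟧
      π = ⟦ p d a ⟧

    image-form : ∀ q →
      lineForm α π ⟦ apply d γ q ⟧ₚ ≈ lineForm α π ⟦ q ⟧ₚ + shift γ α * axis γ ⟦ q ⟧ₚ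
    image-form q = ≈-trans (lineForm-cong (+ d) α π (apply-≈ γ q))
                           (≡⇒≈ (lineForm-act γ α π ⟦ q ⟧ₚ))

    shift-zero⇒preserves : shift γ α ≈ + 0 → ∀ q → _∈L_ d q a → _∈L_ d (apply d γ q) a
    shift-zero⇒preserves c≈0 q q∈L = ≈0⇒∈L a (apply d γ q)
      (≈-trans (image-form q) (+-cong (∈L⇒≈0 a q q∈L) (zero-*ʳ (axis γ ⟦ q ⟧ₚ) c≈0)))

    shift-zero⇒not-distinct : shift γ α ≈ + 0 → ¬ Distinct d γ a
    shift-zero⇒not-distinct c≈0 distinct = distinct λ P → into-image P , from-image P
      where
      into-image : ∀ P → _∈L_ d P a → _∈γL_[_] d P γ a
      into-image P P∈L = apply d γ P , shift-zero⇒preserves c≈0 P P∈L , apply-involutive γ P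
      from-image : ∀ P → _∈γL_[_] d P γ a → _∈L_ d P a
      from-image _ (q , q∈L , refl) = shift-zero⇒preserves c≈0 q q∈L

    product-vanishes : ∀ q → _∈L_ d q a → _∈L_ d (apply d γ q) a →
      shift γ α * axis γ ⟦ q ⟧ₚ ≈ + 0
    product-vanishes q q∈L γq∈L = ≈-trans (≡⇒≈ (difference A cw))
      (−-cong (≈-trans (≈-sym (image-form q)) (∈L⇒≈0 a (apply d γ q) γq∈L)) (∈L⇒≈0 a q q∈L))
      where
      A cw : ℤ
      A = lineForm α π ⟦ q ⟧ₚ
      cw = shift γ α * axis γ ⟦ q ⟧ₚ
      difference : ∀ A B → B ≡ (A + B) - A
      difference = solve-∀

    axis-zero⇒fixed-image : ∀ q → axis γ ⟦ q ⟧ₚ ≈ + 0 → Fixed d γ (apply d γ q)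
    axis-zero⇒fixed-image q w≈0 = trans (apply-involutive γ q) (point-injective _ _
      (≈ₚ-trans (≈ₚ-sym (axis-zero⇒fixed (+ d) γ ⟦ q ⟧ₚ w≈0)) (≈ₚ-sym (apply-≈ γ q))))

proposition1 : (d : ℕ) .{{_ : NonZero d}} → Prime d → 5 ≤ d →
    (γ : Inv) (a : F d) → a ≢ fromNat d 0 → a ≢ ⊝_ d (fromNat d 1) →
    Distinct d γ a →
    ∀ P → _∈L_ d P a → _∈γL_[_] d P γ a → Fixed d γ P
-- Write P = γ q with q ∈ L_a; as d is prime, shift or axis vanishes at q.
-- A vanishing shift contradicts distinctness; a vanishing axis makes P fixed.
proposition1 d d-prime _ γ a _ _ distinct _ γq∈L (q , q∈L , refl)
  with Residues.zero-product d d-prime _ _ (Model.product-vanishes d γ a q q∈L γq∈L)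
... | inj₁ shift≈0 = contradiction distinct (Model.shift-zero⇒not-distinct d γ a shift≈0)
... | inj₂ axis≈0  = Model.axis-zero⇒fixed-image d γ a q axis≈0
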